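{- For every integer $q\ge 11$ there exists an $\mathcal{SOS}_q(2)$ $U^*$ whose weight $w_q(U^*)$ is coprime to $q$ and whose period is \begin{align*} \tfrac{(q-2)(q-4)}{2}-3 &\quad\text{if } q\equiv 0 \pmod 4,\\ \tfrac{(q-1)(q-5)}{2}-3 &\quad\text{if } q\equiv 1 \pmod 4,\\ \tfrac{(q-2)(q-6)}{2}-3 &\quad\text{if } q\equiv 2 \pmod 4,\\ \tfrac{(q-1)(q-3)}{2}-3 &\quad\text{if } q\equiv 3 \pmod 4. \end{align*}
   Context: Sequences are periodic with entries in $\mathbb{Z}_q$, period $m$, described by their ring sequence (one period). Write $\mathbf{s}_n(i)=(s_i,\ldots,s_{i+n-1})$; $\mathbf{u}^R$ denotes the reverse and $-\mathbf{u}$ the entrywise negative of a tuple $\mathbf{u}$. An $\mathcal{SOS}_q(n)$ is a periodic sequence such that $\mathbf{s}_n(i)=\mathbf{s}_n(j)$ implies $i\equiv j\pmod m$, and for all $i,j$: $\mathbf{s}_n(i)\neq\mathbf{s}_n(j)^R$ and $\mathbf{s}_n(i)\neq-\mathbf{s}_n(j)^R$. The weight $w(S)$ is the sum of the ring sequence terms treated as integers in $[0,q-1]$, and $w_q(S)=w(S)\bmod q$. -}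

module Defs where

open import Data.Nat using (ℕ; zero; suc; _+_; _*_; _∸_; NonZero; _/_; _%_)
open import Data.Fin using (Fin; toℕ; fromℕ<)
open import Data.Fin.Properties using ()
open import Data.Nat.DivMod using (m%n<n)
open import Data.Vec.Functional using (Vector)
open import Data.Product using (_×_)
open import Data.Empty using (⊥)
import Data.Fin as F
open import Relation.Binary.PropositionalEquality using (_≡_; _≢_)

-- A periodic sequence over ℤ_q with period m is given by its ring sequence
-- (one period) s : Fin m → Fin q;  s_i = s (i mod m) for i : ℕ.
entry : ∀ {q m} .{{_ : NonZero m}} → (Fin m → Fin q) → ℕ → Fin q
entry {m = m} s i = s (fromℕ< (m%n<n i m))

window : ∀ {q m} .{{_ : NonZero m}} → (n : ℕ) → (Fin m → Fin q) → ℕ → Vector (Fin q) n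
window n s i k = entry s (i + toℕ k)

rev : ∀ {A : Set} {n} → Vector A n → Vector A n
rev {n = n} u k = u (F.opposite k)

negFin : ∀ {q} .{{_ : NonZero q}} → Fin q → Fin q
negFin {q} x = fromℕ< (m%n<n (q ∸ toℕ x) q)

neg : ∀ {q n} .{{_ : NonZero q}} → Vector (Fin q) n → Vector (Fin q) n
neg u k = negFin (u k)

_≈v_ : ∀ {A : Set} {n} → Vector A n → Vector A n → Set
u ≈v v = ∀ k → u k ≡ v k

record IsSOS (q n m : ℕ) .{{_ : NonZero q}} .{{_ : NonZero m}} (s : Fin m → Fin q) : Set where
  field
    distinct : ∀ i j → window n s i ≈v window n s j → i % m ≡ j % m
    noRev    : ∀ i j → (window n s i ≈v rev (window n s j) → ⊥)
    noNegRev : ∀ i j → (window n s i ≈v neg (rev (window n s j)) → ⊥)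

weight : ∀ {q m} → (Fin m → Fin q) → ℕ
weight {m = zero} s = 0
weight {m = suc m} s = toℕ (s F.zero) + weight (λ k → s (F.suc k))

weightMod : ∀ {q m} .{{_ : NonZero q}} → (Fin m → Fin q) → ℕ
weightMod {q} s = weight s % q

-- the period prescribed in Corollary 3.25 (q ≥ 11, so no truncation occurs)
targetPeriod : ℕ → ℕ
targetPeriod q with q % 4
... | 0 = ((q ∸ 2) * (q ∸ 4)) / 2 ∸ 3
... | 1 = ((q ∸ 1) * (q ∸ 5)) / 2 ∸ 3
... | 2 = ((q ∸ 2) * (q ∸ 6)) / 2 ∸ 3
... | _ = ((q ∸ 1) * (q ∸ 3)) / 2 ∸ 3

module Submission where

-- A periodic sequence over ℤ_q is an SOS_q(2) as soon as its arcs (s_i, s_{i+1}) are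
-- pairwise distinct and no arc (u, v) occurs together with (v, u) or with (-v, -u).
-- Such a closed walk is built on the vertices 0, ±1, …, ±h with 5 ≤ h and 2h < q: the
-- block of j enters ⁺j, runs the 4-cycles ⁺j → ⁺k → ⁻j → ⁻k → ⁺j for j < k ≤ h and
-- leaves through ⁺j → ⁻1 → ⁻j. Every arc obeys an orientation rule violated by its
-- reverse and by its negated reverse, and the arcs appear in strictly increasing
-- lexicographic key, so they are distinct. Modulo q every source ⁺a cancels a source ⁻a,
-- except in the single block entered from 0, so the weight is -1 and coprime to q.
-- Dropping 4-cycles from the first block moves the period in steps of 4 onto the target.

open import Defs
open import Data.Nat using (ℕ; zero; suc; _+_; _*_; _∸_; _≤_; _<_; z≤n; s≤s; _%_; _/_; NonZero)
open import Data.Nat.Properties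
open import Data.Nat.Tactic.RingSolver using (solve-∀)
open import Data.Nat.DivMod using (m%n<n; m≡m%n+[m/n]*n; [m+kn]%n≡m%n; m<n⇒m%n≡m; n%n≡0; m*n/n≡m; _divMod_; result)
open import Data.Nat.Divisibility using (_∣_; _∣0; ∣-refl; ∣-trans; ∣m∣n⇒∣m+n; ∣m+n∣m⇒∣n; ∣n⇒∣m*n; ∣1⇒≡1)
open import Data.Nat.Coprimality using (Coprime)
open import Data.Nat.ListAction using (sum)
open import Data.Nat.ListAction.Properties using (sum-++)
open import Data.Fin as F using (Fin; toℕ; fromℕ<)
open import Data.Fin.Properties using (toℕ-fromℕ<; toℕ-fromℕ; toℕ-inject₁; toℕ-injective)
open import Data.List using (List; []; _∷_; _++_; length; map; lookup)
open import Data.List.Properties using (++-assoc; length-++; map-++)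
open import Data.List.Relation.Unary.All as All using (All; []; _∷_)
open import Data.List.Relation.Unary.AllPairs as AllPairs using (_∷_)
open import Data.List.Relation.Unary.Linked as Linked using (Linked; [-]; _∷_)
open import Data.List.Relation.Unary.Linked.Properties using (Linked⇒AllPairs)
open import Data.List.Relation.Unary.Unique.Propositional using (Unique)
open import Data.List.Membership.Propositional.Properties using (∈-lookup)
open import Data.Product using (Σ; _×_; ∃-syntax; _,_; proj₁; proj₂; swap)
open import Data.Product.Properties using (×-≡,≡→≡)
open import Data.Product.Relation.Binary.Lex.Strict using (×-Lex; ×-isStrictPartialOrder)
open import Data.Product.Relation.Binary.Pointwise.NonDependent using (Pointwise)
open import Data.Sum using (_⊎_; inj₁; inj₂)
open import Data.Empty using (⊥; ⊥-elim)
open import Data.Unit using (⊤; tt)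
open import Function using (_∘_)
open import Function.Definitions using (Injective)
open import Level using (0ℓ)
open import Relation.Binary using (Rel; Transitive; IsStrictPartialOrder)
open import Relation.Binary.PropositionalEquality using (_≡_; _≢_; refl; sym; trans; cong; cong₂; subst; module ≡-Reasoning)
open import Relation.Nullary using (¬_)

Key : Set
Key = ℕ × ℕ × ℕ

_≺_ : Rel Key 0ℓ
_≺_ = ×-Lex _≡_ _<_ (×-Lex _≡_ _<_ _<_)

≺-isStrictPartialOrder : IsStrictPartialOrder (Pointwise _≡_ (Pointwise _≡_ _≡_)) _≺_
≺-isStrictPartialOrder =
  ×-isStrictPartialOrder <-isStrictPartialOrder
    (×-isStrictPartialOrder <-isStrictPartialOrder <-isStrictPartialOrder)

≺-trans : Transitive _≺_
≺-trans = IsStrictPartialOrder.trans ≺-isStrictPartialOrder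

≺-irrefl : ∀ {x} → ¬ x ≺ x
≺-irrefl = IsStrictPartialOrder.irrefl ≺-isStrictPartialOrder (refl , refl , refl)

≺-first : ∀ {i j k l r s} → i < j → (i , k , r) ≺ (j , l , s)
≺-first = inj₁

≺-second : ∀ {j k l r s} → k < l → (j , k , r) ≺ (j , l , s)
≺-second k<l = inj₂ (refl , inj₁ k<l)

≺-third : ∀ {j k r s} → r < s → (j , k , r) ≺ (j , k , s)
≺-third r<s = inj₂ (refl , inj₂ (refl , r<s))

≺-raise : ∀ {x j k l} → x ≺ (j , k , 0) → k ≤ l → x ≺ (j , l , 0)
≺-raise (inj₁ i<j)                  _   = inj₁ i<j
≺-raise (inj₂ (refl , inj₁ k′<k))   k≤l = ≺-second (<-≤-trans k′<k k≤l)
≺-raise (inj₂ (refl , inj₂ (_ , ()))) _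

periodic : ∀ {A : Set} {m} .{{_ : NonZero m}} → (Fin m → A) → ℕ → A
periodic {m = m} f i = f (fromℕ< (m%n<n i m))

suc-% : ∀ i m .{{_ : NonZero m}} → suc i % m ≡ suc (i % m) % m
suc-% i m = trans (cong (λ n → suc n % m) (m≡m%n+[m/n]*n i m)) ([m+kn]%n≡m%n (suc (i % m)) (i / m) m)

lookup-cong : ∀ {A : Set} (xs : List A) {k l} → toℕ k ≡ toℕ l → lookup xs k ≡ lookup xs l
lookup-cong xs = cong (lookup xs) ∘ toℕ-injective

Unique-lookup-injective : ∀ {A : Set} {xs : List A} → Unique xs → Injective _≡_ _≡_ (lookup xs)
Unique-lookup-injective (_ ∷ _)      {F.zero}  {F.zero}  _  = refl
Unique-lookup-injective (x∉ ∷ _)     {F.zero}  {F.suc l} eq = ⊥-elim (All.lookup x∉ (∈-lookup l) eq)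
Unique-lookup-injective (x∉ ∷ _)     {F.suc k} {F.zero}  eq = ⊥-elim (All.lookup x∉ (∈-lookup k) (sym eq))
Unique-lookup-injective (_ ∷ unique) {F.suc k} {F.suc l} eq = cong F.suc (Unique-lookup-injective unique eq)

∣1+n⇒coprime-% : ∀ {n q} .{{_ : NonZero q}} → q ∣ suc n → Coprime (n % q) q
∣1+n⇒coprime-% {n} {q} q∣1+n {d} (d∣n%q , d∣q) = ∣1⇒≡1 (∣m+n∣m⇒∣n d∣n+1 d∣n)
  where
  d∣n : d ∣ n
  d∣n = subst (d ∣_) (sym (m≡m%n+[m/n]*n n q)) (∣m∣n⇒∣m+n d∣n%q (∣n⇒∣m*n (n / q) d∣q))
  d∣n+1 : d ∣ n + 1
  d∣n+1 = subst (d ∣_) (+-comm 1 n) (∣-trans d∣q q∣1+n)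

module _ {A : Set} where

  data Chain (R : Rel A 0ℓ) : A → List A → A → Set where
    []  : ∀ {x} → Chain R x [] x
    _∷_ : ∀ {x y ys w} → R x y → Chain R y ys w → Chain R x (y ∷ ys) w

  module _ {R : Rel A 0ℓ} where

    infixr 5 _++ᶜ_

    _++ᶜ_ : ∀ {x xs w ys v} → Chain R x xs w → Chain R w ys v → Chain R x (xs ++ ys) v
    []      ++ᶜ c′ = c′
    (r ∷ c) ++ᶜ c′ = r ∷ (c ++ᶜ c′)

    Chain-map : ∀ {S : Rel A 0ℓ} → (∀ {x y} → R x y → S x y) → ∀ {x ys w} → Chain R x ys w → Chain S x ys w
    Chain-map f []      = []
    Chain-map f (r ∷ c) = f r ∷ Chain-map f c

    Chain-All : ∀ {P : A → Set} → (∀ {x y} → R x y → P y) → ∀ {x ys w} → Chain R x ys w → All P ys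
    Chain-All f []      = []
    Chain-All f (r ∷ c) = f r ∷ Chain-All f c

    Chain⇒Linked : ∀ {x ys w} → Chain R x ys w → Linked R (x ∷ ys)
    Chain⇒Linked []              = [-]
    Chain⇒Linked (r ∷ [])        = r ∷ [-]
    Chain⇒Linked (r ∷ c@(_ ∷ _)) = r ∷ Chain⇒Linked c

    Chain-predecessor : ∀ {x ys w} → Chain R x ys w →
                        (k : Fin (length ys)) → R (lookup (x ∷ ys) (F.inject₁ k)) (lookup ys k)
    Chain-predecessor (r ∷ c) F.zero    = r
    Chain-predecessor (r ∷ c) (F.suc k) = Chain-predecessor c k

    Chain-last : ∀ {x ys w} → Chain R x ys w → lookup (x ∷ ys) (F.fromℕ (length ys)) ≡ w
    Chain-last []      = refl
    Chain-last (r ∷ c) = Chain-last c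

    -- In w ∷ xs the predecessor of position (1 + i) mod m sits at position 1 + (i mod m):
    -- either literally, or both positions are 0 and m, which both hold w.
    Chain-periodic : ∀ {w xs} .{{_ : NonZero (length xs)}} → Chain R w xs w →
                     ∀ i → R (periodic (lookup xs) i) (periodic (lookup xs) (suc i))
    Chain-periodic {w} {xs} closed i =
      subst (λ a → R a (periodic (lookup xs) (suc i))) predecessor (Chain-predecessor closed next)
      where
      open ≡-Reasoning
      m : ℕ
      m = length xs
      next : Fin m
      next = fromℕ< (m%n<n (suc i) m)
      predecessor : lookup (w ∷ xs) (F.inject₁ next) ≡ periodic (lookup xs) i
      predecessor with m≤n⇒m<n∨m≡n (m%n<n i m)
      ... | inj₁ 1+r<m = lookup-cong (w ∷ xs) (begin
        toℕ (F.inject₁ next)              ≡⟨ toℕ-inject₁ next ⟩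
        toℕ next                          ≡⟨ toℕ-fromℕ< _ ⟩
        suc i % m                         ≡⟨ suc-% i m ⟩
        suc (i % m) % m                   ≡⟨ m<n⇒m%n≡m 1+r<m ⟩
        suc (i % m)                       ≡⟨ cong suc (toℕ-fromℕ< _) ⟨
        toℕ (F.suc (fromℕ< (m%n<n i m))) ∎)
      ... | inj₂ 1+r≡m = begin
        lookup (w ∷ xs) (F.inject₁ next) ≡⟨ lookup-cong (w ∷ xs) wraps ⟩
        w                                ≡⟨ Chain-last closed ⟨
        lookup (w ∷ xs) (F.fromℕ m)      ≡⟨ lookup-cong (w ∷ xs) last≡1+r ⟩
        periodic (lookup xs) i           ∎
        where
        last≡1+r : toℕ (F.fromℕ m) ≡ toℕ (F.suc (fromℕ< (m%n<n i m)))
        last≡1+r = trans (toℕ-fromℕ m) (trans (sym 1+r≡m) (cong suc (sym (toℕ-fromℕ< _))))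
        wraps : toℕ (F.inject₁ next) ≡ 0
        wraps = begin
          toℕ (F.inject₁ next) ≡⟨ toℕ-inject₁ next ⟩
          toℕ next             ≡⟨ toℕ-fromℕ< _ ⟩
          suc i % m            ≡⟨ suc-% i m ⟩
          suc (i % m) % m      ≡⟨ cong (_% m) 1+r≡m ⟩
          m % m                ≡⟨ n%n≡0 m ⟩
          0                    ∎

negSwap : ∀ {q} .{{_ : NonZero q}} → Fin q × Fin q → Fin q × Fin q
negSwap (u , v) = negFin v , negFin u

module _ {q m} .{{_ : NonZero q}} .{{_ : NonZero m}} (arc : Fin m → Fin q × Fin q)
         (closed : ∀ i → proj₂ (periodic arc i) ≡ proj₁ (periodic arc (suc i))) where

  private
    arc≡window : ∀ i {u} → window 2 (proj₁ ∘ arc) i ≈v u → periodic arc i ≡ (u F.zero , u (F.suc F.zero))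
    arc≡window i eq = ×-≡,≡→≡
      ( trans (cong (proj₁ ∘ periodic arc) (sym (+-identityʳ i))) (eq F.zero)
      , trans (closed i) (trans (cong (proj₁ ∘ periodic arc) (+-comm 1 i)) (eq (F.suc F.zero))))

    arc≡own-window : ∀ j → periodic arc j ≡ (window 2 (proj₁ ∘ arc) j F.zero ,
                                             window 2 (proj₁ ∘ arc) j (F.suc F.zero))
    arc≡own-window j = arc≡window j (λ _ → refl)

  closedWalk⇒IsSOS : Injective _≡_ _≡_ arc →
                     (∀ k l → arc k ≢ swap (arc l)) → (∀ k l → arc k ≢ negSwap (arc l)) →
                     IsSOS q 2 m (proj₁ ∘ arc)
  closedWalk⇒IsSOS injective noReversal noNegReversal = record
    { distinct = λ i j eq → index-injective i j (injective (trans (arc≡window i eq) (sym (arc≡own-window j))))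
    ; noRev    = λ i j eq → noReversal _ _ (trans (arc≡window i eq) (cong swap (sym (arc≡own-window j))))
    ; noNegRev = λ i j eq → noNegReversal _ _ (trans (arc≡window i eq) (cong negSwap (sym (arc≡own-window j))))
    }
    where
    index-injective : ∀ i j → fromℕ< (m%n<n i m) ≡ fromℕ< (m%n<n j m) → i % m ≡ j % m
    index-injective i j eq = trans (sym (toℕ-fromℕ< _)) (trans (cong toℕ eq) (toℕ-fromℕ< _))

data Vertex : Set where
  𝟘     : Vertex
  ⁺_ ⁻_ : ℕ → Vertex

Arc : Set
Arc = Vertex × Vertex

Connects : Rel Arc 0ℓ
Connects a b = proj₂ a ≡ proj₁ b

negᵛ : Vertex → Vertex
negᵛ 𝟘     = 𝟘
negᵛ (⁺ a) = ⁻ a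
negᵛ (⁻ a) = ⁺ a

negSwapᵛ : Arc → Arc
negSwapᵛ (u , v) = negᵛ v , negᵛ u

Bounded : ℕ → Vertex → Set
Bounded h 𝟘     = ⊤
Bounded h (⁺ a) = 1 ≤ a × a ≤ h
Bounded h (⁻ a) = 1 ≤ a × a ≤ h

BoundedArc : ℕ → Arc → Set
BoundedArc h (u , v) = Bounded h u × Bounded h v

Bounded-negᵛ : ∀ {h v} → Bounded h v → Bounded h (negᵛ v)
Bounded-negᵛ {v = 𝟘}   b = b
Bounded-negᵛ {v = ⁺ _} b = b
Bounded-negᵛ {v = ⁻ _} b = b

BoundedArc-negSwapᵛ : ∀ {h a} → BoundedArc h a → BoundedArc h (negSwapᵛ a)
BoundedArc-negSwapᵛ (bu , bv) = Bounded-negᵛ bv , Bounded-negᵛ bu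

module Encoding (q h : ℕ) .{{_ : NonZero q}} (h+h<q : h + h < q) where

  value : Vertex → ℕ
  value 𝟘     = 0
  value (⁺ a) = a
  value (⁻ a) = q ∸ a

  enc : Vertex → Fin q
  enc v = fromℕ< (m%n<n (value v) q)

  encArc : Arc → Fin q × Fin q
  encArc (u , v) = enc u , enc v

  h<q∸h : h < q ∸ h
  h<q∸h = m+n≤o⇒m≤o∸n (suc h) h+h<q

  h<q : h < q
  h<q = <-≤-trans h<q∸h (m∸n≤m q h)

  ≤h⇒≤q : ∀ {a} → a ≤ h → a ≤ q
  ≤h⇒≤q a≤h = ≤-trans a≤h (<⇒≤ h<q)

  value⁺<value⁻ : ∀ {a b} → a ≤ h → b ≤ h → value (⁺ a) < value (⁻ b)
  value⁺<value⁻ a≤h b≤h = <-≤-trans (≤-<-trans a≤h h<q∸h) (∸-monoʳ-≤ q b≤h)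

  value<q : ∀ {v} → Bounded h v → value v < q
  value<q {𝟘}   _           = ≤-<-trans z≤n h<q
  value<q {⁺ a} (_ , a≤h)   = ≤-<-trans a≤h h<q
  value<q {⁻ a} (1≤a , a≤h) = ∸-monoʳ-< {o = 0} 1≤a (≤h⇒≤q a≤h)

  toℕ-enc : ∀ {v} → Bounded h v → toℕ (enc v) ≡ value v
  toℕ-enc bv = trans (toℕ-fromℕ< _) (m<n⇒m%n≡m (value<q bv))

  value-injective : ∀ {u v} → Bounded h u → Bounded h v → value u ≡ value v → u ≡ v
  value-injective {𝟘}   {𝟘}   _         _         _  = refl
  value-injective {𝟘}   {⁺ b} _         (1≤b , _) eq = ⊥-elim (<⇒≢ 1≤b eq)
  value-injective {𝟘}   {⁻ b} _         (_ , b≤h) eq = ⊥-elim (<⇒≢ (value⁺<value⁻ z≤n b≤h) eq)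
  value-injective {⁺ a} {𝟘}   (1≤a , _) _         eq = ⊥-elim (<⇒≢ 1≤a (sym eq))
  value-injective {⁺ a} {⁺ b} _         _         eq = cong ⁺_ eq
  value-injective {⁺ a} {⁻ b} (_ , a≤h) (_ , b≤h) eq = ⊥-elim (<⇒≢ (value⁺<value⁻ a≤h b≤h) eq)
  value-injective {⁻ a} {𝟘}   (_ , a≤h) _         eq = ⊥-elim (<⇒≢ (value⁺<value⁻ z≤n a≤h) (sym eq))
  value-injective {⁻ a} {⁺ b} (_ , a≤h) (_ , b≤h) eq = ⊥-elim (<⇒≢ (value⁺<value⁻ b≤h a≤h) (sym eq))
  value-injective {⁻ a} {⁻ b} (_ , a≤h) (_ , b≤h) eq = cong ⁻_ (∸-cancelˡ-≡ (≤h⇒≤q a≤h) (≤h⇒≤q b≤h) eq)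

  encArc-injective : ∀ {a b} → BoundedArc h a → BoundedArc h b → encArc a ≡ encArc b → a ≡ b
  encArc-injective (bu , bv) (bu′ , bv′) eq = ×-≡,≡→≡
    ( value-injective bu bu′ (trans (sym (toℕ-enc bu)) (trans (cong (toℕ ∘ proj₁) eq) (toℕ-enc bu′)))
    , value-injective bv bv′ (trans (sym (toℕ-enc bv)) (trans (cong (toℕ ∘ proj₂) eq) (toℕ-enc bv′))))

  negFin-enc : ∀ {v} → Bounded h v → negFin (enc v) ≡ enc (negᵛ v)
  negFin-enc {v} bv = toℕ-injective (begin
    toℕ (negFin (enc v))  ≡⟨ toℕ-fromℕ< _ ⟩
    (q ∸ toℕ (enc v)) % q ≡⟨ cong (λ n → (q ∸ n) % q) (toℕ-enc bv) ⟩
    (q ∸ value v) % q     ≡⟨ negated v bv ⟩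
    value (negᵛ v) % q    ≡⟨ toℕ-fromℕ< _ ⟨
    toℕ (enc (negᵛ v))    ∎)
    where
    open ≡-Reasoning
    negated : ∀ v → Bounded h v → (q ∸ value v) % q ≡ value (negᵛ v) % q
    negated 𝟘     _         = trans (n%n≡0 q) (sym (m<n⇒m%n≡m (value<q {𝟘} tt)))
    negated (⁺ a) _         = refl
    negated (⁻ a) (_ , a≤h) = cong (_% q) (m∸[m∸n]≡n (≤h⇒≤q a≤h))

  negSwap-encArc : ∀ {a} → BoundedArc h a → negSwap (encArc a) ≡ encArc (negSwapᵛ a)
  negSwap-encArc (bu , bv) = cong₂ _,_ (negFin-enc bv) (negFin-enc bu)

  sourceSum : List Arc → ℕ
  sourceSum = sum ∘ map (value ∘ proj₁)

  sourceSum-++ : ∀ xs ys → sourceSum (xs ++ ys) ≡ sourceSum xs + sourceSum ys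
  sourceSum-++ xs ys = trans (cong sum (map-++ (value ∘ proj₁) xs ys)) (sum-++ (map (value ∘ proj₁) xs) _)

  weight-sources : ∀ {xs} → All (BoundedArc h) xs → weight (enc ∘ proj₁ ∘ lookup xs) ≡ sourceSum xs
  weight-sources []              = refl
  weight-sources ((bu , _) ∷ bs) = cong₂ _+_ (toℕ-enc bu) (weight-sources bs)

loop : ℕ → ℕ → List Arc
loop j k = (⁺ j , ⁺ k) ∷ (⁺ k , ⁻ j) ∷ (⁻ j , ⁻ k) ∷ (⁻ k , ⁺ j) ∷ []

loops : ℕ → ℕ → ℕ → List Arc
loops j k zero    = []
loops j k (suc c) = loop j k ++ loops j (suc k) c

blockTail : ℕ → ℕ → ℕ → Vertex → List Arc
blockTail j k c x = loops j k c ++ (⁺ j , ⁻ 1) ∷ (⁻ 1 , ⁻ j) ∷ (⁻ j , x) ∷ []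

block : Vertex → ℕ → ℕ → ℕ → Vertex → List Arc
block s j k c x = (s , ⁺ j) ∷ blockTail j k c x

-- The blocks j, …, j + c - 1, all with their 4-cycles running up to k = j + c + 1.
fullBlocks : ℕ → ℕ → List Arc
fullBlocks j zero    = []
fullBlocks j (suc c) = block (⁺ 1) j (suc j) (2 + c) (⁺ 1) ++ fullBlocks (suc j) c

walk : ℕ → ℕ → List Arc
walk e c =
  block (⁺ 1) 2 3 c 𝟘 ++ block 𝟘 3 4 (2 + e) (⁺ 1) ++ fullBlocks 4 e ++
  block (⁺ 1) (4 + e) (5 + e) 1 𝟘 ++ (𝟘 , ⁺ 1) ∷ []

fullBlocks-fit : ∀ c j {h} → suc c + j < h → suc j + (2 + c) ≤ suc h
fullBlocks-fit c j {h} top = subst (_≤ suc h) (rearrange c j) (s≤s top)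
  where
  rearrange : ∀ c j → suc (suc (suc c + j)) ≡ suc j + (2 + c)
  rearrange = solve-∀

walkLength : ℕ → ℕ → ℕ
walkLength e c = 4 * c + 2 * e * e + 14 * e + 25

length-loops : ∀ j k c → length (loops j k c) ≡ c * 4
length-loops j k zero    = refl
length-loops j k (suc c) = cong (4 +_) (length-loops j (suc k) c)

length-block : ∀ s j k c x → length (block s j k c x) ≡ suc c * 4
length-block s j k c x =
  cong suc (trans (length-++ (loops j k c)) (trans (cong (_+ 3) (length-loops j k c)) (+-comm (c * 4) 3)))

length-fullBlocks : ∀ j c → length (fullBlocks j c) ≡ 2 * c * c + 10 * c
length-fullBlocks j zero    = refl
length-fullBlocks j (suc c) = begin
  length (B ++ fullBlocks (suc j) c)               ≡⟨ length-++ B ⟩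
  length B + length (fullBlocks (suc j) c)         ≡⟨ cong₂ _+_ (length-block (⁺ 1) j (suc j) (2 + c) (⁺ 1))
                                                                (length-fullBlocks (suc j) c) ⟩
  (3 + c) * 4 + (2 * c * c + 10 * c)               ≡⟨ normalise c ⟩
  2 * suc c * suc c + 10 * suc c                   ∎
  where
  open ≡-Reasoning
  B : List Arc
  B = block (⁺ 1) j (suc j) (2 + c) (⁺ 1)
  normalise : ∀ c → (3 + c) * 4 + (2 * c * c + 10 * c) ≡ 2 * suc c * suc c + 10 * suc c
  normalise = solve-∀

length-walk : ∀ e c → length (walk e c) ≡ walkLength e c
length-walk e c = begin
  length (B₂ ++ B₃ ++ F ++ Bₗ ++ fin)
    ≡⟨ length-++ B₂ ⟩
  length B₂ + length (B₃ ++ F ++ Bₗ ++ fin)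
    ≡⟨ cong (length B₂ +_) (length-++ B₃) ⟩
  length B₂ + (length B₃ + length (F ++ Bₗ ++ fin))
    ≡⟨ cong (λ n → length B₂ + (length B₃ + n)) (length-++ F) ⟩
  length B₂ + (length B₃ + (length F + length (Bₗ ++ fin)))
    ≡⟨ cong (λ n → length B₂ + (length B₃ + (length F + n))) (length-++ Bₗ {fin}) ⟩
  length B₂ + (length B₃ + (length F + (length Bₗ + 1)))
    ≡⟨ cong₂ (λ m n → m + (n + (length F + (length Bₗ + 1))))
             (length-block (⁺ 1) 2 3 c 𝟘) (length-block 𝟘 3 4 (2 + e) (⁺ 1)) ⟩
  suc c * 4 + ((3 + e) * 4 + (length F + (length Bₗ + 1)))
    ≡⟨ cong₂ (λ m n → suc c * 4 + ((3 + e) * 4 + (m + (n + 1))))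
             (length-fullBlocks 4 e) (length-block (⁺ 1) (4 + e) (5 + e) 1 𝟘) ⟩
  suc c * 4 + ((3 + e) * 4 + ((2 * e * e + 10 * e) + (2 * 4 + 1)))
    ≡⟨ normalise e c ⟩
  walkLength e c ∎
  where
  open ≡-Reasoning
  B₂ B₃ F Bₗ fin : List Arc
  B₂  = block (⁺ 1) 2 3 c 𝟘
  B₃  = block 𝟘 3 4 (2 + e) (⁺ 1)
  F   = fullBlocks 4 e
  Bₗ  = block (⁺ 1) (4 + e) (5 + e) 1 𝟘
  fin = (𝟘 , ⁺ 1) ∷ []
  normalise : ∀ e c → suc c * 4 + ((3 + e) * 4 + ((2 * e * e + 10 * e) + (2 * 4 + 1)))
                      ≡ 4 * c + 2 * e * e + 14 * e + 25
  normalise = solve-∀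

module WalkProperties (e : ℕ) where

  h : ℕ
  h = 5 + e

  Oriented : Arc → Set
  Oriented (⁺ a , ⁺ b) = a < b
  Oriented (⁻ a , ⁻ b) = a < b
  Oriented (⁺ a , ⁻ b) = b < a
  Oriented (⁻ a , ⁺ b) = b < a
  Oriented (𝟘   , ⁺ b) = b ≡ 1 ⊎ b ≡ 3
  Oriented (⁻ a , 𝟘)   = a ≡ 2 ⊎ a ≡ 4 + e
  Oriented _           = ⊥

  Oriented-swap : ∀ {a} → Oriented a → ¬ Oriented (swap a)
  Oriented-swap {𝟘   , 𝟘}   ()
  Oriented-swap {𝟘   , ⁺ _} _   ()
  Oriented-swap {𝟘   , ⁻ _} ()
  Oriented-swap {⁺ _ , 𝟘}   ()
  Oriented-swap {⁺ _ , ⁺ _} a<b b<a = <-asym a<b b<a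
  Oriented-swap {⁺ _ , ⁻ _} b<a a<b = <-asym a<b b<a
  Oriented-swap {⁻ _ , 𝟘}   _   ()
  Oriented-swap {⁻ _ , ⁺ _} b<a a<b = <-asym a<b b<a
  Oriented-swap {⁻ _ , ⁻ _} a<b b<a = <-asym a<b b<a

  Oriented-negSwap : ∀ {a} → Oriented a → ¬ Oriented (negSwapᵛ a)
  Oriented-negSwap {𝟘   , 𝟘}   ()
  Oriented-negSwap {𝟘   , ⁺ _} (inj₁ refl) (inj₁ ())
  Oriented-negSwap {𝟘   , ⁺ _} (inj₁ refl) (inj₂ ())
  Oriented-negSwap {𝟘   , ⁺ _} (inj₂ refl) (inj₁ ())
  Oriented-negSwap {𝟘   , ⁺ _} (inj₂ refl) (inj₂ ())
  Oriented-negSwap {𝟘   , ⁻ _} ()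
  Oriented-negSwap {⁺ _ , 𝟘}   ()
  Oriented-negSwap {⁺ _ , ⁺ _} a<b b<a = <-asym a<b b<a
  Oriented-negSwap {⁺ _ , ⁻ _} b<a a<b = <-asym a<b b<a
  Oriented-negSwap {⁻ _ , 𝟘}   (inj₁ refl) (inj₁ ())
  Oriented-negSwap {⁻ _ , 𝟘}   (inj₁ refl) (inj₂ ())
  Oriented-negSwap {⁻ _ , 𝟘}   (inj₂ refl) (inj₁ ())
  Oriented-negSwap {⁻ _ , 𝟘}   (inj₂ refl) (inj₂ ())
  Oriented-negSwap {⁻ _ , ⁺ _} b<a a<b = <-asym a<b b<a
  Oriented-negSwap {⁻ _ , ⁻ _} a<b b<a = <-asym a<b b<a

  -- Block j is keyed by (j, 0, 0) on entry, (j, k, r) on the r-th arc of its 4-cycle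
  -- through k, and (j, h + 1, r) on its exit; the walk lists its arcs in strictly
  -- increasing key. For each sign of the first vertex the clauses testing its label
  -- against 1 come last, so that keys still reduce when that label is a variable.
  key : Arc → Key
  key (𝟘   , ⁺ 1) = h , 0 , 0
  key (𝟘   , ⁺ b) = b , 0 , 0
  key (⁺ a , ⁻ 1) = a , suc h , 0
  key (⁺ a , ⁻ b) = b , a , 1
  key (⁺ 1 , ⁺ b) = b , 0 , 0
  key (⁺ a , ⁺ b) = a , b , 0
  key (⁻ a , ⁺ 1) = a , suc h , 2
  key (⁻ a , ⁺ b) = b , a , 3
  key (⁻ a , 𝟘)   = a , suc h , 2
  key (⁻ 1 , ⁻ b) = b , suc h , 1
  key (⁻ a , ⁻ b) = a , b , 2
  key _           = 0 , 0 , 0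

  record Step (a b : Arc) : Set where
    constructor step
    field
      oriented  : Oriented b
      bounded   : BoundedArc h b
      connects  : Connects a b
      increases : key a ≺ key b

  ⁺1-bounded : Bounded h (⁺ 1)
  ⁺1-bounded = ≤-refl , s≤s z≤n

  1<2+n : ∀ {n} → 1 < 2 + n
  1<2+n = s≤s (s≤s z≤n)

  loops-chain : ∀ {j k c a tail w} → 2 + j < k → k + c ≤ suc h →
    proj₂ a ≡ ⁺ (2 + j) → key a ≺ (2 + j , k , 0) →
    (∀ {b} → proj₂ b ≡ ⁺ (2 + j) → key b ≺ (2 + j , suc h , 0) → Chain Step b tail w) →
    Chain Step a (loops (2 + j) k c ++ tail) w
  loops-chain {k = k} {zero} _ k+0≤ a→ a≺ continue =
    continue a→ (≺-raise a≺ (subst (_≤ _) (+-identityʳ k) k+0≤))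
  loops-chain {j} {k} {suc c} j<k k+c≤ a→ a≺ continue =
    step j<k (jB , kB) a→ a≺ ∷
    step j<k (kB , jB) refl (≺-third (s≤s z≤n)) ∷
    step j<k (jB , kB) refl (≺-third (s≤s (s≤s z≤n))) ∷
    step j<k (kB , jB) refl (≺-third (s≤s (s≤s (s≤s z≤n)))) ∷
    loops-chain (m<n⇒m<1+n j<k) (subst (_≤ suc h) (+-suc k c) k+c≤) refl (≺-second (n<1+n k)) continue
    where
    k≤h : k ≤ h
    k≤h = ≤-pred (<-≤-trans (m<m+n k (s≤s z≤n)) k+c≤)
    jB : Bounded h (⁺ (2 + j))
    jB = s≤s z≤n , ≤-trans (<⇒≤ j<k) k≤h
    kB : Bounded h (⁺ k)
    kB = ≤-trans (s≤s z≤n) j<k , k≤h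

  block-chain : ∀ {s j k c x a} → 2 + j < k → k + c ≤ suc h → key (s , ⁺ (2 + j)) ≡ (2 + j , 0 , 0) →
    Step a (s , ⁺ (2 + j)) → Step (⁻ 1 , ⁻ (2 + j)) (⁻ (2 + j) , x) →
    Chain Step a (block s (2 + j) k c x) (⁻ (2 + j) , x)
  block-chain {j = j} {k} {c} j<k k+c≤ entryKey entry exit =
    entry ∷ loops-chain j<k k+c≤ refl (subst (_≺ _) (sym entryKey) (≺-second (≤-trans (s≤s z≤n) j<k))) λ b→ b≺ →
      step 1<2+n (jB , ⁺1-bounded) b→ b≺ ∷
      step 1<2+n (⁺1-bounded , jB) refl (≺-third (s≤s z≤n)) ∷
      exit ∷ []
    where
    jB : Bounded h (⁺ (2 + j))
    jB = s≤s z≤n , ≤-pred (≤-trans j<k (≤-trans (m≤m+n k c) k+c≤))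

  fullBlocks-chain : ∀ {j c a tail w} → c + (2 + j) < h → proj₂ a ≡ ⁺ 1 → key a ≺ (2 + j , 0 , 0) →
    (∀ {b} → proj₂ b ≡ ⁺ 1 → key b ≺ (c + (2 + j) , 0 , 0) → Chain Step b tail w) →
    Chain Step a (fullBlocks (2 + j) c ++ tail) w
  fullBlocks-chain {c = zero} _ a→ a≺ continue = continue a→ a≺
  fullBlocks-chain {j} {suc c} {a} {tail} {w} top a→ a≺ continue =
    subst (λ xs → Chain Step a xs w) (sym (++-assoc B (fullBlocks (3 + j) c) tail))
      (block-chain (n<1+n (2 + j)) (fullBlocks-fit c (2 + j) top) refl
         (step 1<2+n (⁺1-bounded , jB) a→ a≺)
         (step 1<2+n (jB , ⁺1-bounded) refl (≺-third 1<2+n)) ++ᶜ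
       fullBlocks-chain {suc j} {c} (subst (_< h) (sym (+-suc c (2 + j))) top) refl (≺-first (n<1+n (2 + j)))
         λ {b} b→ b≺ → continue b→ (subst (λ n → key b ≺ (n , 0 , 0)) (+-suc c (2 + j)) b≺))
    where
    B : List Arc
    B = block (⁺ 1) (2 + j) (3 + j) (2 + c) (⁺ 1)
    jB : Bounded h (⁺ (2 + j))
    jB = s≤s z≤n , ≤-trans (m≤n+m (2 + j) (suc c)) (<⇒≤ top)

  -- (⁻ 1 , ⁺ 1) is not an arc of the walk: it stands in for the closing arc (𝟘 , ⁺ 1),
  -- which has the same target but whose key is the largest of all.
  walk-chain : ∀ {c} → c ≤ 3 + e → Chain Step (⁻ 1 , ⁺ 1) (walk e c) (𝟘 , ⁺ 1)
  walk-chain c≤ =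
    block-chain {j = 0} ≤-refl (s≤s (s≤s (s≤s c≤))) refl
      (step 1<2+n (⁺1-bounded , b₂) refl (≺-first 1<2+n))
      (step (inj₁ refl) (b₂ , tt) refl (≺-third 1<2+n)) ++ᶜ
    block-chain {j = 1} ≤-refl ≤-refl refl
      (step (inj₂ refl) (tt , b₃) refl (≺-first (n<1+n 2)))
      (step 1<2+n (b₃ , ⁺1-bounded) refl (≺-third 1<2+n)) ++ᶜ
    fullBlocks-chain {j = 2} (≤-reflexive (cong suc (+-comm e 4))) refl (≺-first (n<1+n 3)) λ {b} b→ b≺ →
    block-chain {j = 2 + e} ≤-refl (≤-reflexive (+-comm (5 + e) 1)) refl
      (step 1<2+n (⁺1-bounded , bₕ₋₁) b→ (subst (λ n → key b ≺ (n , 0 , 0)) (+-comm e 4) b≺))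
      (step (inj₂ refl) (bₕ₋₁ , tt) refl (≺-third 1<2+n)) ++ᶜ
    step (inj₁ refl) (tt , ⁺1-bounded) refl (≺-first (n<1+n (4 + e))) ∷ []
    where
    b₂ : Bounded h (⁺ 2)
    b₂ = s≤s z≤n , m≤m+n 2 (3 + e)
    b₃ : Bounded h (⁺ 3)
    b₃ = s≤s z≤n , m≤m+n 3 (2 + e)
    bₕ₋₁ : Bounded h (⁺ (4 + e))
    bₕ₋₁ = s≤s z≤n , n≤1+n (4 + e)

  module _ {c} (c≤ : c ≤ 3 + e) where

    walk-closed : Chain Connects (𝟘 , ⁺ 1) (walk e c) (𝟘 , ⁺ 1)
    walk-closed with Chain-map Step.connects (walk-chain c≤)
    ... | first ∷ rest = first ∷ rest

    walk-bounded : All (BoundedArc h) (walk e c)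
    walk-bounded = Chain-All Step.bounded (walk-chain c≤)

    walk-oriented : All Oriented (walk e c)
    walk-oriented = Chain-All Step.oriented (walk-chain c≤)

    walk-unique : Unique (walk e c)
    walk-unique with Linked⇒AllPairs ≺-trans (Linked.map Step.increases (Chain⇒Linked (walk-chain c≤)))
    ... | _ ∷ increasing =
      AllPairs.map (λ a≺b a≡b → ≺-irrefl (subst (λ a → key a ≺ _) a≡b a≺b)) increasing

module WalkWeight (q e : ℕ) .{{_ : NonZero q}} (h+h<q : (5 + e) + (5 + e) < q) where

  open Encoding q (5 + e) h+h<q
  open WalkProperties e using (h)

  ∣-sourceSum-++ : ∀ {m n} xs ys → q ∣ m + sourceSum xs → q ∣ n + sourceSum ys →
                   q ∣ (m + n) + sourceSum (xs ++ ys)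
  ∣-sourceSum-++ {m} {n} xs ys q∣xs q∣ys = subst (q ∣_) (sym split) (∣m∣n⇒∣m+n q∣xs q∣ys)
    where
    interchange : ∀ m n a b → (m + n) + (a + b) ≡ (m + a) + (n + b)
    interchange = solve-∀
    split : (m + n) + sourceSum (xs ++ ys) ≡ (m + sourceSum xs) + (n + sourceSum ys)
    split = trans (cong ((m + n) +_) (sourceSum-++ xs ys)) (interchange m n _ _)

  ∣-opposite-pairs : ∀ {a b} → a ≤ h → b ≤ h → q ∣ a + (b + (value (⁻ a) + (value (⁻ b) + 0)))
  ∣-opposite-pairs {a} {b} a≤h b≤h = subst (q ∣_) (sym pairs≡q+q) (∣m∣n⇒∣m+n ∣-refl ∣-refl)
    where
    regroup : ∀ a b a′ b′ → a + (b + (a′ + (b′ + 0))) ≡ (a + a′) + (b + b′)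
    regroup = solve-∀
    pairs≡q+q : a + (b + ((q ∸ a) + ((q ∸ b) + 0))) ≡ q + q
    pairs≡q+q = trans (regroup a b (q ∸ a) (q ∸ b))
                      (cong₂ _+_ (m+[n∸m]≡n (≤h⇒≤q a≤h)) (m+[n∸m]≡n (≤h⇒≤q b≤h)))

  ∣-loops : ∀ j k c → j ≤ h → k + c ≤ suc h → q ∣ 0 + sourceSum (loops j k c)
  ∣-loops j k zero    _   _    = q ∣0
  ∣-loops j k (suc c) j≤h k+c≤ =
    ∣-sourceSum-++ {0} {0} (loop j k) (loops j (suc k) c)
      (∣-opposite-pairs j≤h (≤-pred (<-≤-trans (m<m+n k (s≤s z≤n)) k+c≤)))
      (∣-loops j (suc k) c j≤h (subst (_≤ suc h) (+-suc k c) k+c≤))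

  -- The entry ⁺ 1 of a block supplies exactly this 1, so for blocks entered from ⁺ 1 the
  -- statement reads q ∣ sourceSum (block (⁺ 1) j k c x) by computation.
  ∣-blockTail : ∀ j k c x → j ≤ h → k + c ≤ suc h → q ∣ 1 + sourceSum (blockTail j k c x)
  ∣-blockTail j k c x j≤h k+c≤ =
    ∣-sourceSum-++ {0} {1} (loops j k c) ((⁺ j , ⁻ 1) ∷ (⁻ 1 , ⁻ j) ∷ (⁻ j , x) ∷ [])
      (∣-loops j k c j≤h k+c≤) (∣-opposite-pairs (s≤s z≤n) j≤h)

  ∣-fullBlocks : ∀ j c → c + j < h → q ∣ 0 + sourceSum (fullBlocks j c)
  ∣-fullBlocks j zero    _   = q ∣0
  ∣-fullBlocks j (suc c) top =
    ∣-sourceSum-++ {0} {0} (block (⁺ 1) j (suc j) (2 + c) (⁺ 1)) (fullBlocks (suc j) c)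
      (∣-blockTail j (suc j) (2 + c) (⁺ 1) (≤-trans (m≤n+m j (suc c)) (<⇒≤ top)) (fullBlocks-fit c j top))
      (∣-fullBlocks (suc j) c (subst (_< h) (sym (+-suc c j)) top))

  ∣-walk : ∀ {c} → c ≤ 3 + e → q ∣ 1 + sourceSum (walk e c)
  ∣-walk {c} c≤ =
    ∣-sourceSum-++ {0} {1} B₂ (B₃ ++ F ++ Bₗ ++ fin)
      (∣-blockTail 2 3 c 𝟘 (m≤m+n 2 (3 + e)) (s≤s (s≤s (s≤s c≤)))) (
    ∣-sourceSum-++ {1} {0} B₃ (F ++ Bₗ ++ fin)
      (∣-blockTail 3 4 (2 + e) (⁺ 1) (m≤m+n 3 (2 + e)) ≤-refl) (
    ∣-sourceSum-++ {0} {0} F (Bₗ ++ fin)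
      (∣-fullBlocks 4 e (≤-reflexive (cong suc (+-comm e 4)))) (
    ∣-sourceSum-++ {0} {0} Bₗ fin
      (∣-blockTail (4 + e) (5 + e) 1 𝟘 (n≤1+n (4 + e)) (≤-reflexive (+-comm (5 + e) 1)))
      (q ∣0))))
    where
    B₂ B₃ F Bₗ fin : List Arc
    B₂  = block (⁺ 1) 2 3 c 𝟘
    B₃  = block 𝟘 3 4 (2 + e) (⁺ 1)
    F   = fullBlocks 4 e
    Bₗ  = block (⁺ 1) (4 + e) (5 + e) 1 𝟘
    fin = (𝟘 , ⁺ 1) ∷ []

record SOS₂WithCoprimeWeight (q : ℕ) .{{_ : NonZero q}} (m : ℕ) : Set where
  field
    {{nonZero}} : NonZero m
    sequence    : Fin m → Fin q
    isSOS       : IsSOS q 2 m sequence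
    coprime     : Coprime (weightMod sequence) q

walk-SOS : ∀ q .{{_ : NonZero q}} e c → 11 + 2 * e ≤ q → c ≤ 3 + e →
           SOS₂WithCoprimeWeight q (length (walk e c))
walk-SOS q e c q-large c≤ = record
  { sequence = proj₁ ∘ arc
  ; isSOS    = closedWalk⇒IsSOS arc closed injective noReversal noNegReversal
  ; coprime  = ∣1+n⇒coprime-% (subst (λ n → q ∣ suc n) (sym (weight-sources (walk-bounded c≤))) (∣-walk c≤))
  }
  where
  rearrange : ∀ e → 11 + 2 * e ≡ suc ((5 + e) + (5 + e))
  rearrange = solve-∀
  h+h<q : (5 + e) + (5 + e) < q
  h+h<q = subst (_≤ q) (rearrange e) q-large
  open Encoding q (5 + e) h+h<q
  open WalkProperties e
  open WalkWeight q e h+h<q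
  arc : Fin (length (walk e c)) → Fin q × Fin q
  arc = encArc ∘ lookup (walk e c)
  bounded : ∀ k → BoundedArc h (lookup (walk e c) k)
  bounded k = All.lookup (walk-bounded c≤) (∈-lookup k)
  oriented : ∀ k → Oriented (lookup (walk e c) k)
  oriented k = All.lookup (walk-oriented c≤) (∈-lookup k)
  closed : ∀ i → proj₂ (periodic arc i) ≡ proj₁ (periodic arc (suc i))
  closed i = cong enc (Chain-periodic (walk-closed c≤) i)
  injective : Injective _≡_ _≡_ arc
  injective {k} {l} eq = Unique-lookup-injective (walk-unique c≤) (encArc-injective (bounded k) (bounded l) eq)
  noReversal : ∀ k l → arc k ≢ swap (arc l)
  noReversal k l eq =
    Oriented-swap (oriented l) (subst Oriented (encArc-injective (bounded k) (swap (bounded l)) eq) (oriented k))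
  noNegReversal : ∀ k l → arc k ≢ negSwap (arc l)
  noNegReversal k l eq = Oriented-negSwap (oriented l) (subst Oriented arcs≡ (oriented k))
    where
    arcs≡ : lookup (walk e c) k ≡ negSwapᵛ (lookup (walk e c) l)
    arcs≡ = encArc-injective (bounded k) (BoundedArc-negSwapᵛ (bounded l)) (trans eq (negSwap-encArc (bounded l)))

m≡[3+p]*2⇒m/2∸3≡p : ∀ {m} p → m ≡ (3 + p) * 2 → m / 2 ∸ 3 ≡ p
m≡[3+p]*2⇒m/2∸3≡p p refl = cong (_∸ 3) (m*n/n≡m (3 + p) 2)

targetPeriod-0mod4 : ∀ q p → q % 4 ≡ 0 → (q ∸ 2) * (q ∸ 4) ≡ (3 + p) * 2 → targetPeriod q ≡ p
targetPeriod-0mod4 q p q%4 product with q % 4 | q%4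
... | _ | refl = m≡[3+p]*2⇒m/2∸3≡p p product

targetPeriod-1mod4 : ∀ q p → q % 4 ≡ 1 → (q ∸ 1) * (q ∸ 5) ≡ (3 + p) * 2 → targetPeriod q ≡ p
targetPeriod-1mod4 q p q%4 product with q % 4 | q%4
... | _ | refl = m≡[3+p]*2⇒m/2∸3≡p p product

targetPeriod-2mod4 : ∀ q p → q % 4 ≡ 2 → (q ∸ 2) * (q ∸ 6) ≡ (3 + p) * 2 → targetPeriod q ≡ p
targetPeriod-2mod4 q p q%4 product with q % 4 | q%4
... | _ | refl = m≡[3+p]*2⇒m/2∸3≡p p product

targetPeriod-3mod4 : ∀ q p → q % 4 ≡ 3 → (q ∸ 1) * (q ∸ 3) ≡ (3 + p) * 2 → targetPeriod q ≡ p
targetPeriod-3mod4 q p q%4 product with q % 4 | q%4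
... | _ | refl = m≡[3+p]*2⇒m/2∸3≡p p product

record WalkParameters (q : ℕ) : Set where
  constructor parameters
  field
    e c     : ℕ
    q-large : 11 + 2 * e ≤ q
    c≤3+e   : c ≤ 3 + e
    period  : targetPeriod q ≡ walkLength e c

parameters-11+s*4 : ∀ {q} s → 11 + s * 4 ≤ q → targetPeriod q ≡ 8 * s * s + 36 * s + 37 → WalkParameters q
parameters-11+s*4 {q} s q-large period =
  parameters (2 * s) (3 + 2 * s) (subst (_≤ q) (fit s) q-large) ≤-refl (trans period (length≡ s))
  where
  fit : ∀ t → 11 + t * 4 ≡ 11 + 2 * (2 * t)
  fit = solve-∀
  length≡ : ∀ t → 8 * t * t + 36 * t + 37 ≡ 4 * (3 + 2 * t) + 2 * (2 * t) * (2 * t) + 14 * (2 * t) + 25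
  length≡ = solve-∀

parameters-13+s*4 : ∀ {q} s → 13 + s * 4 ≤ q → targetPeriod q ≡ 8 * s * s + 40 * s + 45 → WalkParameters q
parameters-13+s*4 {q} s q-large period =
  parameters (1 + 2 * s) (1 + s) (subst (_≤ q) (fit s) q-large) (s≤s (≤-trans (m≤m+n s (s + 0)) (m≤n+m _ 3)))
    (trans period (length≡ s))
  where
  fit : ∀ t → 13 + t * 4 ≡ 11 + 2 * (1 + 2 * t)
  fit = solve-∀
  length≡ : ∀ t → 8 * t * t + 40 * t + 45 ≡ 4 * (1 + t) + 2 * (1 + 2 * t) * (1 + 2 * t) + 14 * (1 + 2 * t) + 25
  length≡ = solve-∀

product-11+s*4 : ∀ s → (10 + s * 4) * (8 + s * 4) ≡ (3 + (8 * s * s + 36 * s + 37)) * 2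
product-11+s*4 = solve-∀

product-13+s*4 : ∀ s → (12 + s * 4) * (8 + s * 4) ≡ (3 + (8 * s * s + 40 * s + 45)) * 2
product-13+s*4 = solve-∀

choose-parameters : ∀ q → 11 ≤ q → WalkParameters q
choose-parameters q 11≤q with m≤n⇒∃[o]m+o≡n 11≤q
... | x , refl with x divMod 4
... | result s F.zero refl =
  parameters-11+s*4 s ≤-refl (targetPeriod-3mod4 (11 + s * 4) _ ([m+kn]%n≡m%n 11 s 4) (product-11+s*4 s))
... | result s (F.suc F.zero) refl =
  parameters-11+s*4 s (n≤1+n _) (targetPeriod-0mod4 (12 + s * 4) _ ([m+kn]%n≡m%n 12 s 4) (product-11+s*4 s))
... | result s (F.suc (F.suc F.zero)) refl =
  parameters-13+s*4 s ≤-refl (targetPeriod-1mod4 (13 + s * 4) _ ([m+kn]%n≡m%n 13 s 4) (product-13+s*4 s))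
... | result s (F.suc (F.suc (F.suc F.zero))) refl =
  parameters-13+s*4 s (n≤1+n _) (targetPeriod-2mod4 (14 + s * 4) _ ([m+kn]%n≡m%n 14 s 4) (product-13+s*4 s))

corollary3p25 : (q : ℕ) {{nzq : NonZero q}} → 11 ≤ q →
    ∃[ m ] Σ (NonZero m) λ nzm →
    Σ (Fin m → Fin q) λ U →
    IsSOS q 2 m {{nzq}} {{nzm}} U
    × Coprime (weightMod U) q
    × m ≡ targetPeriod q
corollary3p25 q 11≤q =
  length (walk e c) , nonZero , sequence , isSOS , coprime , trans (length-walk e c) (sym period)
  where
  open WalkParameters (choose-parameters q 11≤q)
  open SOS₂WithCoprimeWeight (walk-SOS q e c q-large c≤3+e)
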